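{- Let $\sigma,\tau$ be independent uniformly random involutions of $[n]$. Then the mean number of path components of the superposition $\sigma\cup\tau$ is $\sqrt{n} + O(1)$ as $n\to\infty$.
   Context: An involution is a permutation all of whose cycles have length $1$ or $2$ (identified with a partial matching). The superposition $\sigma\cup\tau$ is the multigraph on $[n]$ with a solid edge $\{i,\sigma(i)\}$ for each $2$-cycle of $\sigma$ and a dotted edge $\{i,\tau(i)\}$ for each $2$-cycle of $\tau$ (a $2$-cycle common to both gives two parallel edges). Its components are alternating cycles (every vertex incident to one edge of each kind, including the $2$-vertex double-edge cycle) and alternating paths (including isolated vertices). -}

module Defs where

open import Data.Nat using (ℕ; zero; suc; _+_; _*_; _∸_; _^_; _≤_; _≤ᵇ_)
open import Data.Bool using (Bool; true; false; _∨_; _∧_; not)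
open import Data.Fin using (Fin; zero; suc; toℕ; _≟_)
open import Data.Fin.Properties using (all?)
open import Data.List using (List; []; _∷_; [_]; map; concatMap; filter; length; allFin)
open import Data.Nat.ListAction using (sum)
open import Data.Bool.ListAction using (all; any)
import Data.List as L
open import Relation.Binary.PropositionalEquality using (_≡_)
open import Relation.Nullary using (Dec; does)

IsInvolution : {n : ℕ} → (Fin n → Fin n) → Set
IsInvolution {n} σ = (i : Fin n) → σ (σ i) ≡ i

isInvolution? : {n : ℕ} → (σ : Fin n → Fin n) → Dec (IsInvolution σ)
isInvolution? σ = all? (λ i → σ (σ i) ≟ i)

cons : {n m : ℕ} → Fin m → (Fin n → Fin m) → Fin (suc n) → Fin m
cons j f zero    = j
cons j f (suc i) = f i

allFuns : (n m : ℕ) → List (Fin n → Fin m)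
allFuns zero    m = [ (λ ()) ]
allFuns (suc n) m = concatMap (λ f → map (λ j → cons j f) (allFin m)) (allFuns n m)

involutions : (n : ℕ) → List (Fin n → Fin n)
involutions n = filter isInvolution? (allFuns n n)

-- Superposition σ ∪ τ: v is adjacent to σ v (solid) and τ v (dotted)
-- (for a fixed point this is a harmless self-loop, i.e. no edge).
-- reach σ τ k v w : there is a walk of length ≤ k from v to w.
reach : {n : ℕ} → (Fin n → Fin n) → (Fin n → Fin n) → ℕ → Fin n → Fin n → Bool
reach σ τ zero    v w = does (v ≟ w)
reach σ τ (suc k) v w = reach σ τ k v w ∨ reach σ τ k (σ v) w ∨ reach σ τ k (τ v) w

-- Same connected component of σ ∪ τ (walks of length ≤ n suffice on n vertices).
sameComp : {n : ℕ} → (Fin n → Fin n) → (Fin n → Fin n) → Fin n → Fin n → Bool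
sameComp {n} σ τ v w = reach σ τ n v w

isRep : {n : ℕ} → (Fin n → Fin n) → (Fin n → Fin n) → Fin n → Bool
isRep {n} σ τ v = all (λ w → not (sameComp σ τ v w) ∨ (toℕ v ≤ᵇ toℕ w)) (allFin n)

-- The component of v is a path component, i.e. not an alternating cycle:
-- some vertex of it is not incident to an edge of each kind
-- (it is a fixed point of σ or of τ).
isPathComp : {n : ℕ} → (Fin n → Fin n) → (Fin n → Fin n) → Fin n → Bool
isPathComp {n} σ τ v =
  any (λ w → sameComp σ τ v w ∧ (does (σ w ≟ w) ∨ does (τ w ≟ w))) (allFin n)

pathComponents : {n : ℕ} → (Fin n → Fin n) → (Fin n → Fin n) → ℕ
pathComponents {n} σ τ =
  length (L.filterᵇ (λ v → isRep σ τ v ∧ isPathComp σ τ v) (allFin n))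

totalPaths : ℕ → ℕ
totalPaths n = sum (concatMap (λ σ → map (λ τ → pathComponents σ τ) (involutions n)) (involutions n))

-- Number of pairs (σ, τ) of involutions; the mean is totalPaths n / numPairs n.
numPairs : ℕ → ℕ
numPairs n = length (involutions n) * length (involutions n)

module Submission where

-- A vertex fixed by σ misses its solid edge and a vertex fixed by τ misses its dotted edge; call
-- these missing edges free ends. Alternating cycles have none and every alternating path has
-- exactly two, so 2 · #paths(σ, τ) = fix σ + fix τ. Summing over all pairs, the total number of
-- paths is F(n) · I(n), where I(n) counts the involutions of [n] and F(n) = Σ_σ fix σ = n · I(n-1)
-- (delete the fixed point). So the mean is n · I(n-1) / I(n), and the recurrence
-- I(n+1) = I(n) + n · I(n-1) gives by induction n · I(n-1)² ≤ I(n)² and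
-- (I(n) - I(n-1))² ≤ n · I(n-1)², which place the mean between √n - 1 and √n.

open import Defs
open import Data.Bool using (Bool; true; false; _∨_; _∧_; not; T; T?)
open import Data.Bool.ListAction using (and; all)
open import Data.Bool.Properties using (T-∨; T-∧; ∨-comm; ∨-zeroʳ; ∧-zeroʳ)
open import Data.Empty using (⊥-elim)
open import Data.Fin using (Fin; zero; suc; toℕ; _≟_; punchIn; punchOut)
open import Data.Fin.Properties
  using (0≢1+n; pigeonhole; toℕ<n; punchIn-injective; punchInᵢ≢i; punchIn-punchOut; suc-injective)
open import Data.List using (List; []; _∷_; map; concatMap; filter; length; allFin; tabulate)
open import Data.List.Membership.Propositional using (lose)
open import Data.List.Membership.Propositional.Properties using (∈-allFin)
open import Data.List.Properties using (map-tabulate; map-concatMap; map-∘; map-cong)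
open import Data.List.Relation.Unary.Any using (satisfied)
open import Data.List.Relation.Unary.Any.Properties using (any⁺; any⁻)
open import Data.Nat using (ℕ; zero; suc; _+_; _*_; _∸_; _^_; _≤_; _<_; z≤n; s≤s; _≤′_; ≤′-refl; ≤′-step; _≤ᵇ_)
open import Data.Nat.ListAction using (sum)
open import Data.Nat.ListAction.Properties using (sum-++)
open import Data.Nat.Properties
  using (+-*-semiring; +-comm; +-identityʳ; +-suc; *-comm; *-identityʳ; *-zeroʳ; *-distribˡ-+; *-cancelˡ-≡;
         ≤-refl; ≤-reflexive; ≤-trans; ≤-total; ≤-pred; <⇒≤; ≤⇒≤′; n≤1+n; n<1+n; m<n⇒m<1+n; m≤n⇒m≤1+n;
         m≤n⇒m<n∨m≡n; m≤m+n; m≤n+m; m∸n≤m; m∸n+n≡m; +-monoʳ-≤; *-monoʳ-≤; *-mono-≤; module ≤-Reasoning)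
open import Algebra.Properties.Semiring.Sum +-*-semiring
  using (∑-distrib-+; ∑-comm; sum-remove; *-distribˡ-sum; sum-replicate-zero)
  renaming (sum to ∑; sum-cong-≗ to ∑-cong)
open import Data.Nat.Tactic.RingSolver using (solve-∀)
open import Data.Product using (Σ; _×_; _,_; proj₁; proj₂)
open import Data.Sum using (_⊎_; inj₁; inj₂; [_,_]′)
open import Data.Vec.Functional using (insertAt)
open import Data.Vec.Functional.Properties using (insertAt-lookup; insertAt-punchIn)
open import Function using (_∘_; id; _⇔_; mk⇔; Equivalence)
open import Function.Definitions using (Injective)
open import Relation.Binary.PropositionalEquality
open import Relation.Nullary using (Dec; does; yes; no; ¬_)
open import Relation.Nullary.Decidable using (dec-true; dec-false; does-⇔)

open Equivalence using (to; from)

𝟙 : Bool → ℕ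
𝟙 true  = 1
𝟙 false = 0

does-sound : ∀ {P : Set} (p : Dec P) → T (does p) → P
does-sound (yes p) _ = p
does-sound (no _)  ()

does-complete : ∀ {P : Set} (p : Dec P) → P → T (does p)
does-complete (yes _)  _ = _
does-complete (no ¬p)  p = ¬p p

bool-cases : ∀ b → b ≡ true ⊎ b ≡ false
bool-cases true  = inj₁ refl
bool-cases false = inj₂ refl

T-⇔⇒≡ : ∀ {a b} → (T a → T b) → (T b → T a) → a ≡ b
T-⇔⇒≡ {true}  {true}  _ _ = refl
T-⇔⇒≡ {true}  {false} f _ = ⊥-elim (f _)
T-⇔⇒≡ {false} {true}  _ g = ⊥-elim (g _)
T-⇔⇒≡ {false} {false} _ _ = refl

δ : ∀ {n} → Fin n → Fin n → ℕ
δ a b = 𝟙 (does (a ≟ b))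

δ-≡ : ∀ {n} {a b : Fin n} → a ≡ b → δ a b ≡ 1
δ-≡ {a = a} {b} a≡b = cong 𝟙 (dec-true (a ≟ b) a≡b)

δ-≢ : ∀ {n} {a b : Fin n} → a ≢ b → δ a b ≡ 0
δ-≢ {a = a} {b} a≢b = cong 𝟙 (dec-false (a ≟ b) a≢b)

δ-sym : ∀ {n} (a b : Fin n) → δ a b ≡ δ b a
δ-sym a b = cong 𝟙 (does-⇔ (mk⇔ sym sym) (a ≟ b) (b ≟ a))

∑-const : ∀ {n} c → ∑ {n} (λ _ → c) ≡ n * c
∑-const {zero}  c = refl
∑-const {suc n} c = cong (c +_) (∑-const {n} c)

∑-δ : ∀ {n} (a : Fin n) (h : Fin n → ℕ) → ∑ (λ i → δ i a * h i) ≡ h a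
∑-δ {suc n} zero    h = trans (cong₂ _+_ (+-identityʳ (h zero)) (sum-replicate-zero n)) (+-identityʳ (h zero))
∑-δ {suc n} (suc a) h = ∑-δ a (h ∘ suc)

sum-tabulate : ∀ {n} (f : Fin n → ℕ) → sum (tabulate f) ≡ ∑ f
sum-tabulate {zero}  f = refl
sum-tabulate {suc n} f = cong (f zero +_) (sum-tabulate (f ∘ suc))

sum-map-allFin : ∀ {n} (f : Fin n → ℕ) → sum (map f (allFin n)) ≡ ∑ f
sum-map-allFin f = trans (cong sum (map-tabulate id f)) (sum-tabulate f)

module _ {A : Set} where

  sum-map-cong : ∀ {f g : A → ℕ} → f ≗ g → ∀ l → sum (map f l) ≡ sum (map g l)
  sum-map-cong f≗g []      = refl
  sum-map-cong f≗g (x ∷ l) = cong₂ _+_ (f≗g x) (sum-map-cong f≗g l)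

  sum-map-+ : ∀ (f g : A → ℕ) l → sum (map (λ x → f x + g x) l) ≡ sum (map f l) + sum (map g l)
  sum-map-+ f g []      = refl
  sum-map-+ f g (x ∷ l) = trans (cong (f x + g x +_) (sum-map-+ f g l)) (+-+-shuffle (f x) (g x) _ _)
    where
    +-+-shuffle : ∀ a b c d → a + b + (c + d) ≡ a + c + (b + d)
    +-+-shuffle = solve-∀

  sum-map-*ˡ : ∀ c (f : A → ℕ) l → sum (map (λ x → c * f x) l) ≡ c * sum (map f l)
  sum-map-*ˡ c f []      = sym (*-zeroʳ c)
  sum-map-*ˡ c f (x ∷ l) = trans (cong (c * f x +_) (sum-map-*ˡ c f l)) (sym (*-distribˡ-+ c (f x) _))

  sum-map-∑ : ∀ {k} (H : Fin k → A → ℕ) l → sum (map (λ x → ∑ (λ a → H a x)) l) ≡ ∑ (λ a → sum (map (H a) l))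
  sum-map-∑ {k} H []      = sym (sum-replicate-zero k)
  sum-map-∑     H (x ∷ l) = trans (cong (∑ (λ a → H a x) +_) (sum-map-∑ H l)) (sym (∑-distrib-+ (λ a → H a x) _))

  sum-map-filter : ∀ {P : A → Set} (P? : ∀ x → Dec (P x)) (g : A → ℕ) l →
                   sum (map g (filter P? l)) ≡ sum (map (λ x → 𝟙 (does (P? x)) * g x) l)
  sum-map-filter P? g []      = refl
  sum-map-filter P? g (x ∷ l) with does (P? x)
  ... | true  = cong₂ _+_ (sym (+-identityʳ (g x))) (sum-map-filter P? g l)
  ... | false = sum-map-filter P? g l

  length-filter : ∀ {P : A → Set} (P? : ∀ x → Dec (P x)) l → length (filter P? l) ≡ sum (map (λ x → 𝟙 (does (P? x))) l)
  length-filter P? []      = refl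
  length-filter P? (x ∷ l) with does (P? x)
  ... | true  = cong suc (length-filter P? l)
  ... | false = length-filter P? l

  sum-concatMap : (F : A → List ℕ) → ∀ l → sum (concatMap F l) ≡ sum (map (sum ∘ F) l)
  sum-concatMap F []      = refl
  sum-concatMap F (x ∷ l) = trans (sum-++ (F x) _) (cong (sum (F x) +_) (sum-concatMap F l))

∑funs : (n m : ℕ) → ((Fin n → Fin m) → ℕ) → ℕ
∑funs n m h = sum (map h (allFuns n m))

Extensional : ∀ {n m} → ((Fin n → Fin m) → ℕ) → Set
Extensional h = ∀ {f g} → f ≗ g → h f ≡ h g

module _ {n m : ℕ} where

  ∑funs-cong : ∀ {h h′ : (Fin n → Fin m) → ℕ} → h ≗ h′ → ∑funs n m h ≡ ∑funs n m h′
  ∑funs-cong h≗h′ = sum-map-cong h≗h′ (allFuns n m)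

  ∑funs-+ : ∀ (h h′ : (Fin n → Fin m) → ℕ) → ∑funs n m (λ f → h f + h′ f) ≡ ∑funs n m h + ∑funs n m h′
  ∑funs-+ h h′ = sum-map-+ h h′ (allFuns n m)

  ∑funs-*ˡ : ∀ c (h : (Fin n → Fin m) → ℕ) → ∑funs n m (λ f → c * h f) ≡ c * ∑funs n m h
  ∑funs-*ˡ c h = sum-map-*ˡ c h (allFuns n m)

  ∑funs-*ʳ : ∀ (h : (Fin n → Fin m) → ℕ) c → ∑funs n m (λ f → h f * c) ≡ ∑funs n m h * c
  ∑funs-*ʳ h c = trans (∑funs-cong (λ f → *-comm (h f) c)) (trans (∑funs-*ˡ c h) (*-comm c _))

  ∑funs-0 : ∑funs n m (λ _ → 0) ≡ 0
  ∑funs-0 = ∑funs-*ˡ 0 (λ _ → 0)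

  ∑funs-∑ : ∀ {k} (H : Fin k → (Fin n → Fin m) → ℕ) → ∑funs n m (λ f → ∑ (λ a → H a f)) ≡ ∑ (λ a → ∑funs n m (H a))
  ∑funs-∑ H = sum-map-∑ H (allFuns n m)

cons-≗ : ∀ {n m} (j : Fin m) {f g : Fin n → Fin m} → f ≗ g → cons j f ≗ cons j g
cons-≗ j f≗g zero    = refl
cons-≗ j f≗g (suc i) = f≗g i

cons-insertAt-zero : ∀ {n m} (j : Fin m) (g : Fin n → Fin m) → cons j g ≗ insertAt g zero j
cons-insertAt-zero j g zero    = refl
cons-insertAt-zero j g (suc i) = refl

insertAt-≗ : ∀ {n m} (a : Fin (suc n)) (j : Fin m) {f g : Fin n → Fin m} → f ≗ g → insertAt f a j ≗ insertAt g a j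
insertAt-≗ zero    j f≗g zero    = refl
insertAt-≗ zero    j f≗g (suc i) = f≗g i
insertAt-≗ {suc n} (suc a) j f≗g zero    = f≗g zero
insertAt-≗ {suc n} (suc a) j f≗g (suc i) = insertAt-≗ a j (f≗g ∘ suc) i

cons-insertAt-suc : ∀ {n m} (a : Fin (suc n)) (j j₀ : Fin m) (g : Fin n → Fin m) →
                    cons j₀ (insertAt g a j) ≗ insertAt (cons j₀ g) (suc a) j
cons-insertAt-suc a j j₀ g zero    = refl
cons-insertAt-suc a j j₀ g (suc i) = refl

cons-punchIn : ∀ {n m} (b : Fin (suc m)) (j : Fin m) (g : Fin n → Fin m) →
               cons (punchIn b j) (punchIn b ∘ g) ≗ punchIn b ∘ cons j g
cons-punchIn b j g zero    = refl
cons-punchIn b j g (suc i) = refl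

∑funs-suc : ∀ {n m} (h : (Fin (suc n) → Fin m) → ℕ) → ∑funs (suc n) m h ≡ ∑funs n m (λ f → ∑ (λ j → h (cons j f)))
∑funs-suc {n} {m} h = begin
  sum (map h (concatMap F (allFuns n m)))           ≡⟨ cong sum (map-concatMap h F (allFuns n m)) ⟩
  sum (concatMap (map h ∘ F) (allFuns n m))         ≡⟨ sum-concatMap (map h ∘ F) (allFuns n m) ⟩
  sum (map (sum ∘ map h ∘ F) (allFuns n m))         ≡⟨ sum-map-cong row (allFuns n m) ⟩
  ∑funs n m (λ f → ∑ (λ j → h (cons j f)))          ∎
  where
  open ≡-Reasoning
  F : (Fin n → Fin m) → List (Fin (suc n) → Fin m)
  F f = map (λ j → cons j f) (allFin m)
  row : ∀ f → sum (map h (F f)) ≡ ∑ (λ j → h (cons j f))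
  row f = trans (cong sum (sym (map-∘ (allFin m)))) (sum-map-allFin (λ j → h (cons j f)))

∑funs-insertAt : ∀ {n m} (a : Fin (suc n)) (h : (Fin (suc n) → Fin m) → ℕ) → Extensional h →
                 ∑funs (suc n) m h ≡ ∑ (λ j → ∑funs n m (λ g → h (insertAt g a j)))
∑funs-insertAt zero h ext = trans (∑funs-suc h) (trans (∑funs-∑ (λ j f → h (cons j f)))
  (∑-cong (λ j → ∑funs-cong (λ g → ext (cons-insertAt-zero j g)))))
∑funs-insertAt {suc n} {m} (suc a) h ext = begin
  ∑funs (suc (suc n)) m h
    ≡⟨ ∑funs-suc h ⟩
  ∑funs (suc n) m (λ f → ∑ (λ j₀ → h (cons j₀ f)))
    ≡⟨ ∑funs-∑ (λ j₀ f → h (cons j₀ f)) ⟩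
  ∑ (λ j₀ → ∑funs (suc n) m (λ f → h (cons j₀ f)))
    ≡⟨ ∑-cong (λ j₀ → ∑funs-insertAt a (λ f → h (cons j₀ f)) (ext ∘ cons-≗ j₀)) ⟩
  ∑ (λ j₀ → ∑ (λ j → ∑funs n m (λ g → h (cons j₀ (insertAt g a j)))))
    ≡⟨ ∑-comm (λ j₀ j → ∑funs n m (λ g → h (cons j₀ (insertAt g a j)))) ⟩
  ∑ (λ j → ∑ (λ j₀ → ∑funs n m (λ g → h (cons j₀ (insertAt g a j)))))
    ≡⟨ ∑-cong (λ j → sym (∑funs-∑ (λ j₀ g → h (cons j₀ (insertAt g a j))))) ⟩
  ∑ (λ j → ∑funs n m (λ g → ∑ (λ j₀ → h (cons j₀ (insertAt g a j)))))
    ≡⟨ ∑-cong (λ j → ∑funs-cong (λ g → ∑-cong (λ j₀ → ext (cons-insertAt-suc a j j₀ g)))) ⟩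
  ∑ (λ j → ∑funs n m (λ g → ∑ (λ j₀ → h (insertAt (cons j₀ g) (suc a) j))))
    ≡⟨ ∑-cong (λ j → sym (∑funs-suc (λ g → h (insertAt g (suc a) j)))) ⟩
  ∑ (λ j → ∑funs (suc n) m (λ g → h (insertAt g (suc a) j))) ∎
  where open ≡-Reasoning

∑funs-punchIn : ∀ {n m} (b : Fin (suc m)) (h : (Fin n → Fin (suc m)) → ℕ) → Extensional h →
                (∀ f x → f x ≡ b → h f ≡ 0) → ∑funs n (suc m) h ≡ ∑funs n m (λ g → h (punchIn b ∘ g))
∑funs-punchIn {zero}      b h ext avoids = cong (_+ 0) (ext (λ ()))
∑funs-punchIn {suc n} {m} b h ext avoids = begin
  ∑funs (suc n) (suc m) h
    ≡⟨ ∑funs-suc h ⟩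
  ∑funs n (suc m) (λ f → ∑ (λ j → h (cons j f)))
    ≡⟨ ∑funs-punchIn b (λ f → ∑ (λ j → h (cons j f))) (λ f≗g → ∑-cong (λ j → ext (cons-≗ j f≗g)))
         (λ f x fx≡b → trans (∑-cong (λ j → avoids (cons j f) (suc x) fx≡b)) (sum-replicate-zero (suc m))) ⟩
  ∑funs n m (λ g → ∑ (λ j → h (cons j (punchIn b ∘ g))))
    ≡⟨ ∑funs-cong (λ g → sum-remove {i = b} (λ j → h (cons j (punchIn b ∘ g)))) ⟩
  ∑funs n m (λ g → h (cons b (punchIn b ∘ g)) + ∑ (λ j → h (cons (punchIn b j) (punchIn b ∘ g))))
    ≡⟨ ∑funs-cong (λ g → cong₂ _+_ (avoids (cons b (punchIn b ∘ g)) zero refl)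
                                   (∑-cong (λ j → ext (cons-punchIn b j g)))) ⟩
  ∑funs n m (λ g → ∑ (λ j → h (punchIn b ∘ cons j g)))
    ≡⟨ sym (∑funs-suc (λ g → h (punchIn b ∘ g))) ⟩
  ∑funs (suc n) m (λ g → h (punchIn b ∘ g)) ∎
  where open ≡-Reasoning

-- Involutions and their fixed points

𝟙-inv : ∀ {n} → (Fin n → Fin n) → ℕ
𝟙-inv f = 𝟙 (does (isInvolution? f))

𝟙-inv-⇔ : ∀ {n k} (f : Fin n → Fin n) (g : Fin k → Fin k) → IsInvolution f ⇔ IsInvolution g → 𝟙-inv f ≡ 𝟙-inv g
𝟙-inv-⇔ f g f⇔g = cong 𝟙 (does-⇔ f⇔g (isInvolution? f) (isInvolution? g))

𝟙-inv-ext : ∀ {n} → Extensional (𝟙-inv {n})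
𝟙-inv-ext {f = f} {g} f≗g = 𝟙-inv-⇔ f g (mk⇔ (transport f≗g) (transport (sym ∘ f≗g)))
  where
  transport : ∀ {f g} → f ≗ g → IsInvolution f → IsInvolution g
  transport {f} {g} f≗g inv i = trans (cong g (sym (f≗g i))) (trans (sym (f≗g (f i))) (inv i))

𝟙-inv-non : ∀ {n} (f : Fin n → Fin n) → ¬ IsInvolution f → 𝟙-inv f ≡ 0
𝟙-inv-non f ¬inv = cong 𝟙 (dec-false (isInvolution? f) ¬inv)

involution-flip : ∀ {n} (f : Fin n → Fin n) → IsInvolution f → ∀ {x y} → f x ≡ y → f y ≡ x
involution-flip f inv {x} refl = inv x

involution-restrict : ∀ {n N} (f : Fin N → Fin N) (g : Fin n → Fin n) (e : Fin n → Fin N) →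
  Injective _≡_ _≡_ e → (∀ x → f (e x) ≡ e (g x)) → (∀ y → f (f y) ≡ y ⊎ Σ (Fin n) (λ x → y ≡ e x)) →
  IsInvolution f ⇔ IsInvolution g
involution-restrict f g e e-inj f∘e≡e∘g covered = mk⇔ restrict extend
  where
  restrict : IsInvolution f → IsInvolution g
  restrict inv x = e-inj (trans (sym (f∘e≡e∘g (g x))) (trans (cong f (sym (f∘e≡e∘g x))) (inv (e x))))
  extend : IsInvolution g → IsInvolution f
  extend inv y with covered y
  ... | inj₁ ffy≡y      = ffy≡y
  ... | inj₂ (x , refl) = trans (cong f (f∘e≡e∘g x)) (trans (f∘e≡e∘g (g x)) (cong e (inv x)))

involutionCount : ℕ → ℕ
involutionCount n = ∑funs n n 𝟙-inv

length-involutions : ∀ n → length (involutions n) ≡ involutionCount n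
length-involutions n = length-filter isInvolution? (allFuns n n)

∑inv : ∀ n → ((Fin n → Fin n) → ℕ) → ℕ
∑inv n h = ∑funs n n (λ f → 𝟙-inv f * h f)

module _ {n : ℕ} where

  ∑inv-cong : ∀ {h h′ : (Fin n → Fin n) → ℕ} → (∀ f → IsInvolution f → h f ≡ h′ f) → ∑inv n h ≡ ∑inv n h′
  ∑inv-cong {h} {h′} h≡h′ = ∑funs-cong pointwise
    where
    pointwise : ∀ f → 𝟙-inv f * h f ≡ 𝟙-inv f * h′ f
    pointwise f with isInvolution? f
    ... | yes inv  = cong (𝟙-inv f *_) (h≡h′ f inv)
    ... | no ¬inv = trans (cong (_* h f) (𝟙-inv-non f ¬inv)) (sym (cong (_* h′ f) (𝟙-inv-non f ¬inv)))

  ∑inv-*ˡ : ∀ c (h : (Fin n → Fin n) → ℕ) → ∑inv n (λ f → c * h f) ≡ c * ∑inv n h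
  ∑inv-*ˡ c h = trans (∑funs-cong (λ f → x*[y*z]≡y*[x*z] (𝟙-inv f) c (h f))) (∑funs-*ˡ c (λ f → 𝟙-inv f * h f))
    where
    x*[y*z]≡y*[x*z] : ∀ x y z → x * (y * z) ≡ y * (x * z)
    x*[y*z]≡y*[x*z] = solve-∀

  ∑inv-+ : ∀ (h h′ : (Fin n → Fin n) → ℕ) → ∑inv n (λ f → h f + h′ f) ≡ ∑inv n h + ∑inv n h′
  ∑inv-+ h h′ = trans (∑funs-cong (λ f → *-distribˡ-+ (𝟙-inv f) (h f) (h′ f)))
                      (∑funs-+ (λ f → 𝟙-inv f * h f) (λ f → 𝟙-inv f * h′ f))

  ∑inv-const : ∀ c → ∑inv n (λ _ → c) ≡ involutionCount n * c
  ∑inv-const c = ∑funs-*ʳ {n} 𝟙-inv c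

involutions-fixing : ∀ n (a : Fin (suc n)) → ∑funs n (suc n) (λ g → 𝟙-inv (insertAt g a a)) ≡ involutionCount n
involutions-fixing n a =
  trans (∑funs-punchIn a (λ g → 𝟙-inv (insertAt g a a)) (𝟙-inv-ext ∘ insertAt-≗ a a) hits-a)
        (∑funs-cong (λ g → 𝟙-inv-⇔ (insertAt (punchIn a ∘ g) a a) g (restrict g)))
  where
  hits-a : ∀ g x → g x ≡ a → 𝟙-inv (insertAt g a a) ≡ 0
  hits-a g x gx≡a = 𝟙-inv-non (insertAt g a a) λ inv → punchInᵢ≢i a x
    (sym (trans (sym (insertAt-lookup g a a)) (involution-flip (insertAt g a a) inv (trans (insertAt-punchIn g a a x) gx≡a))))
  restrict : ∀ g → IsInvolution (insertAt (punchIn a ∘ g) a a) ⇔ IsInvolution g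
  restrict g = involution-restrict f g (punchIn a) (punchIn-injective a _ _) (insertAt-punchIn (punchIn a ∘ g) a a) covered
    where
    f : Fin (suc n) → Fin (suc n)
    f = insertAt (punchIn a ∘ g) a a
    covered : ∀ y → f (f y) ≡ y ⊎ Σ _ (λ x → y ≡ punchIn a x)
    covered y with a ≟ y
    ... | yes refl = inj₁ (trans (cong f (insertAt-lookup _ a a)) (insertAt-lookup _ a a))
    ... | no a≢y   = inj₂ (punchOut a≢y , sym (punchIn-punchOut a≢y))

involutions-pairing-zero : ∀ n (k : Fin (suc n)) →
  ∑funs (suc n) (suc (suc n)) (λ g → 𝟙-inv (cons (suc k) g)) ≡ involutionCount n
involutions-pairing-zero n k = begin
  ∑funs (suc n) (suc (suc n)) (λ g → 𝟙-inv (cons (suc k) g))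
    ≡⟨ ∑funs-insertAt k (λ g → 𝟙-inv (cons (suc k) g)) (𝟙-inv-ext ∘ cons-≗ (suc k)) ⟩
  ∑ (λ j → ∑funs n (suc (suc n)) (λ g → 𝟙-inv (cons (suc k) (insertAt g k j))))
    ≡⟨ cong (∑funs n (suc (suc n)) (λ g → 𝟙-inv (pair g)) +_) (trans (∑-cong unpaired) (sum-replicate-zero (suc n))) ⟩
  ∑funs n (suc (suc n)) (λ g → 𝟙-inv (pair g)) + 0
    ≡⟨ +-identityʳ _ ⟩
  ∑funs n (suc (suc n)) (λ g → 𝟙-inv (pair g))
    ≡⟨ ∑funs-punchIn zero (λ g → 𝟙-inv (pair g))
                      (λ g≗g′ → 𝟙-inv-ext (cons-≗ (suc k) (insertAt-≗ k zero g≗g′))) hits-zero ⟩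
  ∑funs n (suc n) (λ g → 𝟙-inv (pair (suc ∘ g)))
    ≡⟨ ∑funs-punchIn k (λ g → 𝟙-inv (pair (suc ∘ g)))
                      (λ g≗g′ → 𝟙-inv-ext (cons-≗ (suc k) (insertAt-≗ k zero (cong suc ∘ g≗g′)))) hits-k ⟩
  ∑funs n n (λ h → 𝟙-inv (pair (embed ∘ h)))
    ≡⟨ ∑funs-cong (λ h → 𝟙-inv-⇔ (pair (embed ∘ h)) h (restrict h)) ⟩
  involutionCount n ∎
  where
  open ≡-Reasoning
  pair : (Fin n → Fin (suc (suc n))) → Fin (suc (suc n)) → Fin (suc (suc n))
  pair g = cons (suc k) (insertAt g k zero)
  embed : Fin n → Fin (suc (suc n))
  embed = suc ∘ punchIn k
  unpaired : ∀ j → ∑funs n (suc (suc n)) (λ g → 𝟙-inv (cons (suc k) (insertAt g k (suc j)))) ≡ 0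
  unpaired j = trans (∑funs-cong (λ g → 𝟙-inv-non (cons (suc k) (insertAt g k (suc j))) (not-involution g))) (∑funs-0 {n} {suc (suc n)})
    where
    not-involution : ∀ g → ¬ IsInvolution (cons (suc k) (insertAt g k (suc j)))
    not-involution g inv = 0≢1+n (trans (sym (involution-flip (cons (suc k) (insertAt g k (suc j))) inv {zero} refl))
                                (insertAt-lookup g k (suc j)))
  hits-zero : ∀ g x → g x ≡ zero → 𝟙-inv (pair g) ≡ 0
  hits-zero g x gx≡0 = 𝟙-inv-non (pair g) λ inv → punchInᵢ≢i k x
    (sym (suc-injective (involution-flip (pair g) inv {suc (punchIn k x)} (trans (insertAt-punchIn g k zero x) gx≡0))))
  hits-k : ∀ g x → g x ≡ k → 𝟙-inv (pair (suc ∘ g)) ≡ 0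
  hits-k g x gx≡k = 𝟙-inv-non (pair (suc ∘ g)) λ inv → 0≢1+n
    (trans (sym (insertAt-lookup (suc ∘ g) k zero))
           (involution-flip (pair (suc ∘ g)) inv {suc (punchIn k x)} (trans (insertAt-punchIn (suc ∘ g) k zero x) (cong suc gx≡k))))
  restrict : ∀ h → IsInvolution (pair (embed ∘ h)) ⇔ IsInvolution h
  restrict h = involution-restrict f h embed (punchIn-injective k _ _ ∘ suc-injective)
                 (insertAt-punchIn (embed ∘ h) k zero) covered
    where
    f : Fin (suc (suc n)) → Fin (suc (suc n))
    f = pair (embed ∘ h)
    covered : ∀ y → f (f y) ≡ y ⊎ Σ _ (λ x → y ≡ embed x)
    covered zero = inj₁ (insertAt-lookup (embed ∘ h) k zero)
    covered (suc y) with k ≟ y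
    ... | yes refl = inj₁ (cong f (insertAt-lookup (embed ∘ h) k zero))
    ... | no k≢y   = inj₂ (punchOut k≢y , cong suc (sym (punchIn-punchOut k≢y)))

involutionCount-suc-suc : ∀ n → involutionCount (suc (suc n)) ≡ involutionCount (suc n) + suc n * involutionCount n
involutionCount-suc-suc n = begin
  involutionCount (suc (suc n))
    ≡⟨ ∑funs-suc {suc n} 𝟙-inv ⟩
  ∑funs (suc n) (suc (suc n)) (λ g → ∑ (λ j → 𝟙-inv (cons j g)))
    ≡⟨ ∑funs-∑ {suc n} (λ j g → 𝟙-inv (cons j g)) ⟩
  ∑funs (suc n) (suc (suc n)) (λ g → 𝟙-inv (cons zero g)) + ∑ (λ k → ∑funs (suc n) (suc (suc n)) (λ g → 𝟙-inv (cons (suc k) g)))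
    ≡⟨ cong₂ _+_ (trans (∑funs-cong {suc n} (λ g → 𝟙-inv-ext (cons-insertAt-zero zero g))) (involutions-fixing (suc n) zero))
                 (trans (∑-cong (involutions-pairing-zero n)) (∑-const {suc n} (involutionCount n))) ⟩
  involutionCount (suc n) + suc n * involutionCount n ∎
  where open ≡-Reasoning

fixedPoints : ∀ {n} → (Fin n → Fin n) → ℕ
fixedPoints f = ∑ (λ a → δ (f a) a)

∑inv-fixes : ∀ n (a : Fin (suc n)) → ∑inv (suc n) (λ f → δ (f a) a) ≡ involutionCount n
∑inv-fixes n a = begin
  ∑funs (suc n) (suc n) (λ f → 𝟙-inv f * δ (f a) a)
    ≡⟨ ∑funs-insertAt a (λ f → 𝟙-inv f * δ (f a) a)
                       (λ f≗g → cong₂ _*_ (𝟙-inv-ext f≗g) (cong (λ z → δ z a) (f≗g a))) ⟩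
  ∑ (λ j → ∑funs n (suc n) (λ g → 𝟙-inv (insertAt g a j) * δ (insertAt g a j a) a))
    ≡⟨ ∑-cong (λ j → ∑funs-cong (λ g → trans (cong (λ z → 𝟙-inv (insertAt g a j) * δ z a) (insertAt-lookup g a j))
                                              (*-comm (𝟙-inv (insertAt g a j)) _))) ⟩
  ∑ (λ j → ∑funs n (suc n) (λ g → δ j a * 𝟙-inv (insertAt g a j)))
    ≡⟨ ∑-cong (λ j → ∑funs-*ˡ (δ j a) (λ g → 𝟙-inv (insertAt g a j))) ⟩
  ∑ (λ j → δ j a * ∑funs n (suc n) (λ g → 𝟙-inv (insertAt g a j)))
    ≡⟨ ∑-δ a (λ j → ∑funs n (suc n) (λ g → 𝟙-inv (insertAt g a j))) ⟩
  ∑funs n (suc n) (λ g → 𝟙-inv (insertAt g a a))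
    ≡⟨ involutions-fixing n a ⟩
  involutionCount n ∎
  where open ≡-Reasoning

∑inv-fixedPoints : ∀ n → ∑inv (suc n) fixedPoints ≡ suc n * involutionCount n
∑inv-fixedPoints n = begin
  ∑funs (suc n) (suc n) (λ f → 𝟙-inv f * fixedPoints f)
    ≡⟨ ∑funs-cong {suc n} (λ f → *-distribˡ-sum (𝟙-inv f) (λ a → δ (f a) a)) ⟩
  ∑funs (suc n) (suc n) (λ f → ∑ (λ a → 𝟙-inv f * δ (f a) a))
    ≡⟨ ∑funs-∑ {suc n} (λ a f → 𝟙-inv f * δ (f a) a) ⟩
  ∑ (λ a → ∑funs (suc n) (suc n) (λ f → 𝟙-inv f * δ (f a) a))
    ≡⟨ ∑-cong (∑inv-fixes n) ⟩
  ∑ {suc n} (λ _ → involutionCount n)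
    ≡⟨ ∑-const {suc n} (involutionCount n) ⟩
  suc n * involutionCount n ∎
  where open ≡-Reasoning

-- Components of the superposition σ ∪ τ

freeEnds : ∀ {n} → (Fin n → Fin n) → (Fin n → Fin n) → Fin n → ℕ
freeEnds σ τ w = δ (σ w) w + δ (τ w) w

double : ℕ → ℕ
double zero    = 0
double (suc d) = suc (suc (double d))

parity : ∀ g → Σ ℕ (λ d → g ≡ double d ⊎ g ≡ suc (double d))
parity zero = 0 , inj₁ refl
parity (suc g) with parity g
... | d , inj₁ g≡2d   = d , inj₂ (cong suc g≡2d)
... | d , inj₂ g≡2d+1 = suc d , inj₁ (cong suc g≡2d+1)

suc-∸+ : ∀ {i l} → i < l → suc ((l ∸ suc i) + i) ≡ l
suc-∸+ {i} {l} i<l = trans (sym (+-suc (l ∸ suc i) i)) (m∸n+n≡m i<l)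

-- Starting from a τ-fixed vertex u, apply σ, τ, σ, … in turn: the walk runs along the path
-- component of u and first stalls (walk (suc t) ≡ walk t) at the other free end.
module AlternatingWalk {n} (σ τ : Fin n → Fin n) (σ-inv : IsInvolution σ) (τ-inv : IsInvolution τ)
                       (u : Fin n) (τu≡u : τ u ≡ u) where

  open ≡-Reasoning

  step : ℕ → Fin n → Fin n
  step zero          = σ
  step (suc zero)    = τ
  step (suc (suc t)) = step t

  step-involutive : ∀ t → IsInvolution (step t)
  step-involutive zero          = σ-inv
  step-involutive (suc zero)    = τ-inv
  step-involutive (suc (suc t)) = step-involutive t

  step-cases : ∀ t y → (step t y ≡ σ y × step (suc t) y ≡ τ y) ⊎ (step t y ≡ τ y × step (suc t) y ≡ σ y)
  step-cases zero          y = inj₁ (refl , refl)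
  step-cases (suc zero)    y = inj₂ (refl , refl)
  step-cases (suc (suc t)) y = step-cases t y

  step-periodic : ∀ d i → step (double d + i) ≡ step i
  step-periodic zero    i = refl
  step-periodic (suc d) i = step-periodic d i

  walk : ℕ → Fin n
  walk zero    = u
  walk (suc t) = step t (walk t)

  Stops : ℕ → Set
  Stops t = walk (suc t) ≡ walk t

  NoStopBefore : ℕ → Set
  NoStopBefore j = ∀ t → t < j → ¬ Stops t

  walk-back : ∀ t → step t (walk (suc t)) ≡ walk t
  walk-back t = step-involutive t (walk t)

  module _ (j : ℕ) (noStop : NoStopBefore j) where

    -- A repetition at odd distance moves inward (walk i ≡ walk l gives walk (suc i) ≡ walk (l ∸ 1))
    -- until it becomes a stall; one at positive even distance moves down to u, where τ u ≡ u
    -- turns it into one at odd distance.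
    odd-distinct : ∀ d i → suc (double d + i) ≤ j → walk i ≢ walk (suc (double d + i))
    odd-distinct zero    i le eq = noStop i le (sym eq)
    odd-distinct (suc d) i le eq = odd-distinct d (suc i) le′ eq′
      where
      L : ℕ
      L = suc (suc (double d + i))
      shift : double d + suc i ≡ suc (double d + i)
      shift = +-suc (double d) i
      eq′ : walk (suc i) ≡ walk (suc (double d + suc i))
      eq′ = begin
        step i (walk i)                 ≡⟨ cong (step i) eq ⟩
        step i (walk (suc L))           ≡⟨ cong (λ s → s (walk (suc L))) (sym (step-periodic d i)) ⟩
        step (double d + i) (walk (suc L)) ≡⟨ walk-back L ⟩
        walk L                          ≡⟨ cong (walk ∘ suc) (sym shift) ⟩
        walk (suc (double d + suc i))   ∎
      le′ : suc (double d + suc i) ≤ j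
      le′ = subst (λ z → suc z ≤ j) (sym shift) (≤-trans (n≤1+n L) le)

    even-distinct : ∀ i d → suc (suc (double d + i)) ≤ j → walk i ≢ walk (suc (suc (double d + i)))
    even-distinct zero    d le eq = odd-distinct d zero (≤-trans (n≤1+n _) le) (sym (begin
      walk L                        ≡⟨ sym (walk-back L) ⟩
      step L (walk (suc L))         ≡⟨ cong (step L) (sym eq) ⟩
      step (suc (double d + 0)) u   ≡⟨ cong (λ t → step t u) (sym (+-suc (double d) 0)) ⟩
      step (double d + 1) u         ≡⟨ cong (λ s → s u) (step-periodic d 1) ⟩
      τ u                           ≡⟨ τu≡u ⟩
      u                             ∎))
      where
      L : ℕ
      L = suc (double d + 0)
    even-distinct (suc i) d le eq = even-distinct i d le′ (begin
      walk i                             ≡⟨ sym (walk-back i) ⟩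
      step i (walk (suc i))              ≡⟨ cong (step i) (trans eq (cong walk shift)) ⟩
      step i (walk (suc L))              ≡⟨ cong (λ s → s (walk (suc L))) (sym (step-periodic d i)) ⟩
      step (double d + i) (walk (suc L)) ≡⟨ walk-back L ⟩
      walk L                             ∎)
      where
      L : ℕ
      L = suc (suc (double d + i))
      shift : suc (suc (double d + suc i)) ≡ suc L
      shift = cong (λ (z : ℕ) → suc (suc z)) (+-suc (double d) i)
      le′ : L ≤ j
      le′ = ≤-trans (n≤1+n L) (subst (_≤ j) shift le)

    walk-distinct : ∀ i l → i < l → l ≤ j → walk i ≢ walk l
    walk-distinct i l i<l l≤j with l ∸ suc i | parity (l ∸ suc i) | suc-∸+ i<l
    ... | _ | d , inj₁ refl | refl = odd-distinct d i l≤j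
    ... | _ | d , inj₂ refl | refl = even-distinct i d l≤j

  freeEnds-step : ∀ t y → freeEnds σ τ y ≡ δ (step t y) y + δ (step (suc t) y) y
  freeEnds-step t y with step-cases t y
  ... | inj₁ (p , q) = sym (cong₂ _+_ (cong (λ z → δ z y) p) (cong (λ z → δ z y) q))
  ... | inj₂ (p , q) = trans (+-comm (δ (σ y) y) _) (sym (cong₂ _+_ (cong (λ z → δ z y) p) (cong (λ z → δ z y) q)))

  freeEnds-start : freeEnds σ τ u ≡ δ (walk 1) (walk 0) + 1
  freeEnds-start = trans (freeEnds-step 0 u) (cong (δ (σ u) u +_) (δ-≡ τu≡u))

  freeEnds-walk : ∀ t → freeEnds σ τ (walk (suc t)) ≡ δ (walk t) (walk (suc t)) + δ (walk (suc (suc t))) (walk (suc t))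
  freeEnds-walk t = trans (freeEnds-step t (walk (suc t)))
                          (cong (λ z → δ z (walk (suc t)) + δ (walk (suc (suc t))) (walk (suc t))) (walk-back t))

  firstStopBefore : ∀ j → NoStopBefore j ⊎ Σ ℕ (λ k → k < j × Stops k × NoStopBefore k)
  firstStopBefore zero = inj₁ (λ t ())
  firstStopBefore (suc j) with firstStopBefore j
  ... | inj₂ (k , k<j , stop , noStop) = inj₂ (k , m<n⇒m<1+n k<j , stop , noStop)
  ... | inj₁ noStop with walk (suc j) ≟ walk j
  ...   | yes stop = inj₂ (j , ≤-refl , stop , noStop)
  ...   | no ¬stop = inj₁ λ t t<1+j → [ noStop t , (λ { refl → ¬stop }) ]′ (m≤n⇒m<n∨m≡n (≤-pred t<1+j))

  firstStop : Σ ℕ (λ k → k < n × Stops k × NoStopBefore k)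
  firstStop with firstStopBefore n
  ... | inj₂ found   = found
  ... | inj₁ noStop with pigeonhole (n<1+n n) (λ i → walk (toℕ i))
  ...   | i , l , i<l , eq = ⊥-elim (walk-distinct n noStop (toℕ i) (toℕ l) i<l (≤-pred (toℕ<n l)) eq)

module Reach {n} (σ τ : Fin n → Fin n) where

  reach-refl : ∀ k w → T (reach σ τ k w w)
  reach-refl zero    w = does-complete (w ≟ w) refl
  reach-refl (suc k) w = from T-∨ (inj₁ (reach-refl k w))

  reach-mono : ∀ {k k′ a b} → k ≤ k′ → T (reach σ τ k a b) → T (reach σ τ k′ a b)
  reach-mono k≤k′ = mono′ (≤⇒≤′ k≤k′)
    where
    mono′ : ∀ {k k′ a b} → k ≤′ k′ → T (reach σ τ k a b) → T (reach σ τ k′ a b)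
    mono′ ≤′-refl        r = r
    mono′ (≤′-step k≤k′) r = from T-∨ (inj₁ (mono′ k≤k′ r))

  reach-σ : ∀ {k a b} → T (reach σ τ k (σ a) b) → T (reach σ τ (suc k) a b)
  reach-σ {k} {a} {b} r = from (T-∨ {reach σ τ k a b}) (inj₂ (from (T-∨ {reach σ τ k (σ a) b}) (inj₁ r)))

  reach-τ : ∀ {k a b} → T (reach σ τ k (τ a) b) → T (reach σ τ (suc k) a b)
  reach-τ {k} {a} {b} r = from (T-∨ {reach σ τ k a b}) (inj₂ (from (T-∨ {reach σ τ k (σ a) b}) (inj₂ r)))

  reach-closed : (P : Fin n → Bool) → (∀ w → T (P w) → T (P (σ w)) × T (P (τ w))) →
                 ∀ k {a b} → T (reach σ τ k a b) → T (P a) → T (P b)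
  reach-closed P closed zero    {a} {b} r pa = subst (T ∘ P) (does-sound (a ≟ b) r) pa
  reach-closed P closed (suc k) {a}     r pa with to T-∨ r
  ... | inj₁ r′ = reach-closed P closed k r′ pa
  ... | inj₂ r′ with to T-∨ r′
  ...   | inj₁ r″ = reach-closed P closed k r″ (proj₁ (closed a pa))
  ...   | inj₂ r″ = reach-closed P closed k r″ (proj₂ (closed a pa))

  reach-closed⁻ : IsInvolution σ → IsInvolution τ →
                  (P : Fin n → Bool) → (∀ w → T (P w) → T (P (σ w)) × T (P (τ w))) →
                  ∀ k {a b} → T (reach σ τ k a b) → T (P b) → T (P a)
  reach-closed⁻ σ-inv τ-inv P closed zero    {a} {b} r pb = subst (T ∘ P) (sym (does-sound (a ≟ b) r)) pb
  reach-closed⁻ σ-inv τ-inv P closed (suc k) {a}     r pb with to T-∨ r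
  ... | inj₁ r′ = reach-closed⁻ σ-inv τ-inv P closed k r′ pb
  ... | inj₂ r′ with to T-∨ r′
  ...   | inj₁ r″ = subst (T ∘ P) (σ-inv a) (proj₁ (closed (σ a) (reach-closed⁻ σ-inv τ-inv P closed k r″ pb)))
  ...   | inj₂ r″ = subst (T ∘ P) (τ-inv a) (proj₂ (closed (τ a) (reach-closed⁻ σ-inv τ-inv P closed k r″ pb)))

reach-swap : ∀ {n} (σ τ : Fin n → Fin n) k v w → reach σ τ k v w ≡ reach τ σ k v w
reach-swap σ τ zero    v w = refl
reach-swap σ τ (suc k) v w = trans (cong₂ _∨_ (reach-swap σ τ k v w)
                                     (cong₂ _∨_ (reach-swap σ τ k (σ v) w) (reach-swap σ τ k (τ v) w)))
                                   (∨-swap₂₃ (reach τ σ k v w) (reach τ σ k (σ v) w) (reach τ σ k (τ v) w))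
  where
  ∨-swap₂₃ : ∀ a b c → a ∨ b ∨ c ≡ a ∨ c ∨ b
  ∨-swap₂₃ a b c = cong (a ∨_) (∨-comm b c)

sumUpTo : (ℕ → ℕ) → ℕ → ℕ
sumUpTo h zero    = h zero
sumUpTo h (suc t) = sumUpTo h t + h (suc t)

module PathFrom {n} (σ τ : Fin n → Fin n) (σ-inv : IsInvolution σ) (τ-inv : IsInvolution τ)
                (u : Fin n) (τu≡u : τ u ≡ u) (k : ℕ) (k<n : k < n)
                (stops : AlternatingWalk.Stops σ τ σ-inv τ-inv u τu≡u k)
                (noStop : AlternatingWalk.NoStopBefore σ τ σ-inv τ-inv u τu≡u k) where

  open ≡-Reasoning

  open AlternatingWalk σ τ σ-inv τ-inv u τu≡u
  open Reach σ τ

  visited : ℕ → Fin n → Bool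
  visited zero    w = does (walk zero ≟ w)
  visited (suc t) w = visited t w ∨ does (walk (suc t) ≟ w)

  visited-sound : ∀ t {w} → T (visited t w) → Σ ℕ λ s → s ≤ t × walk s ≡ w
  visited-sound zero    {w} v = zero , z≤n , does-sound (walk zero ≟ w) v
  visited-sound (suc t) {w} v with to (T-∨ {visited t w}) v
  ... | inj₁ v′ = let s , s≤t , eq = visited-sound t v′ in s , m≤n⇒m≤1+n s≤t , eq
  ... | inj₂ v′ = suc t , ≤-refl , does-sound (walk (suc t) ≟ w) v′

  visited-complete : ∀ {s} t → s ≤ t → T (visited t (walk s))
  visited-complete zero    z≤n = does-complete (walk zero ≟ walk zero) refl
  visited-complete {s} (suc t) s≤1+t with m≤n⇒m<n∨m≡n s≤1+t
  ... | inj₁ s<1+t = from (T-∨ {visited t (walk s)}) (inj₁ (visited-complete t (≤-pred s<1+t)))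
  ... | inj₂ refl  = from (T-∨ {visited t (walk s)}) (inj₂ (does-complete (walk s ≟ walk s) refl))

  onPath : Fin n → Bool
  onPath = visited k

  onPath-walk : ∀ {s} → s ≤ k → T (onPath (walk s))
  onPath-walk = visited-complete k

  onPath-forward : ∀ {s} → s ≤ k → T (onPath (step s (walk s)))
  onPath-forward s≤k with m≤n⇒m<n∨m≡n s≤k
  ... | inj₁ s<k  = onPath-walk s<k
  ... | inj₂ refl = subst (T ∘ onPath) (sym stops) (onPath-walk ≤-refl)

  onPath-backward : ∀ {s} → s ≤ k → T (onPath (step (suc s) (walk s)))
  onPath-backward {zero}  _     = subst (T ∘ onPath) (sym τu≡u) (onPath-walk z≤n)
  onPath-backward {suc s} s<k = subst (T ∘ onPath) (sym (walk-back s)) (onPath-walk (<⇒≤ s<k))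

  onPath-closed : ∀ w → T (onPath w) → T (onPath (σ w)) × T (onPath (τ w))
  onPath-closed w v with visited-sound k v
  ... | s , s≤k , refl with step-cases s (walk s)
  ...   | inj₁ (fwd≡σ , bwd≡τ) = subst (T ∘ onPath) fwd≡σ (onPath-forward s≤k) , subst (T ∘ onPath) bwd≡τ (onPath-backward s≤k)
  ...   | inj₂ (fwd≡τ , bwd≡σ) = subst (T ∘ onPath) bwd≡σ (onPath-backward s≤k) , subst (T ∘ onPath) fwd≡τ (onPath-forward s≤k)

  reach-step : ∀ t {k′ a b} → T (reach σ τ k′ (step t a) b) → T (reach σ τ (suc k′) a b)
  reach-step t {k′} {a} {b} r with step-cases t a
  ... | inj₁ (step≡σ , _) = reach-σ {k′} {a} {b} (subst (λ z → T (reach σ τ k′ z b)) step≡σ r)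
  ... | inj₂ (step≡τ , _) = reach-τ {k′} {a} {b} (subst (λ z → T (reach σ τ k′ z b)) step≡τ r)

  reach-forward : ∀ d s → T (reach σ τ d (walk s) (walk (d + s)))
  reach-forward zero    s = reach-refl 0 (walk s)
  reach-forward (suc d) s = reach-step s {d} (subst (λ z → T (reach σ τ d (walk (suc s)) (walk z))) (+-suc d s) (reach-forward d (suc s)))

  reach-backward : ∀ d s → T (reach σ τ d (walk (d + s)) (walk s))
  reach-backward zero    s = reach-refl 0 (walk s)
  reach-backward (suc d) s = reach-step (d + s) {d} (subst (λ z → T (reach σ τ d z (walk s))) (sym (walk-back (d + s))) (reach-backward d s))

  onPath-connected : ∀ {a b} → T (onPath a) → T (onPath b) → T (sameComp σ τ a b)
  onPath-connected va vb with visited-sound k va | visited-sound k vb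
  ... | s , s≤k , refl | t , t≤k , refl with ≤-total s t
  ...   | inj₁ s≤t = reach-mono (≤-trans (m∸n≤m t s) (≤-trans t≤k (<⇒≤ k<n)))
                       (subst (λ z → T (reach σ τ (t ∸ s) (walk s) (walk z))) (m∸n+n≡m s≤t) (reach-forward (t ∸ s) s))
  ...   | inj₂ t≤s = reach-mono (≤-trans (m∸n≤m s t) (≤-trans s≤k (<⇒≤ k<n)))
                       (subst (λ z → T (reach σ τ (s ∸ t) (walk z) (walk t))) (m∸n+n≡m t≤s) (reach-backward (s ∸ t) t))

  sameComp-onPath : ∀ {v} → T (onPath v) → ∀ w → sameComp σ τ v w ≡ onPath w
  sameComp-onPath v-on w = T-⇔⇒≡ (λ r → reach-closed onPath onPath-closed n r v-on) (onPath-connected v-on)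

  sameComp-start : ∀ v → sameComp σ τ v u ≡ onPath v
  sameComp-start v = T-⇔⇒≡ (λ r → reach-closed⁻ σ-inv τ-inv onPath onPath-closed n r u-on) (λ v-on → onPath-connected v-on u-on)
    where
    u-on : T (onPath u)
    u-on = onPath-walk z≤n

  ∑-visited : ∀ (h : Fin n → ℕ) t → t ≤ k → ∑ (λ w → 𝟙 (visited t w) * h w) ≡ sumUpTo (h ∘ walk) t
  ∑-visited h zero    _   = trans (∑-cong (λ w → cong (_* h w) (δ-sym (walk zero) w))) (∑-δ (walk zero) h)
  ∑-visited h (suc t) t<k = begin
    ∑ (λ w → 𝟙 (visited t w ∨ does (walk (suc t) ≟ w)) * h w)
      ≡⟨ ∑-cong split ⟩
    ∑ (λ w → 𝟙 (visited t w) * h w + δ w (walk (suc t)) * h w)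
      ≡⟨ ∑-distrib-+ (λ w → 𝟙 (visited t w) * h w) (λ w → δ w (walk (suc t)) * h w) ⟩
    ∑ (λ w → 𝟙 (visited t w) * h w) + ∑ (λ w → δ w (walk (suc t)) * h w)
      ≡⟨ cong₂ _+_ (∑-visited h t (<⇒≤ t<k)) (∑-δ (walk (suc t)) h) ⟩
    sumUpTo (h ∘ walk) t + h (walk (suc t)) ∎
    where
    split : ∀ w → 𝟙 (visited t w ∨ does (walk (suc t) ≟ w)) * h w ≡ 𝟙 (visited t w) * h w + δ w (walk (suc t)) * h w
    split w with visited t w in v
    ... | false = cong (_* h w) (δ-sym (walk (suc t)) w)
    ... | true  with visited-sound t (subst T (sym v) _)
    ...   | s , s≤t , refl = sym (trans (cong (λ z → h w + 0 + z * h w)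
                                          (δ-≢ (walk-distinct k noStop s (suc t) (s≤s s≤t) t<k)))
                                    (+-identityʳ _))

  sumUpTo-freeEnds : ∀ t → t ≤ k → sumUpTo (freeEnds σ τ ∘ walk) t ≡ 1 + δ (walk (suc t)) (walk t)
  sumUpTo-freeEnds zero    _   = trans freeEnds-start (+-comm _ 1)
  sumUpTo-freeEnds (suc t) t<k = begin
    sumUpTo (freeEnds σ τ ∘ walk) t + freeEnds σ τ (walk (suc t))
      ≡⟨ cong₂ _+_ (sumUpTo-freeEnds t (<⇒≤ t<k)) (freeEnds-walk t) ⟩
    1 + δ (walk (suc t)) (walk t) + (δ (walk t) (walk (suc t)) + δ (walk (suc (suc t))) (walk (suc t)))
      ≡⟨ cong₂ (λ a b → 1 + a + (b + δ (walk (suc (suc t))) (walk (suc t)))) (δ-≢ no-stop) (δ-≢ (no-stop ∘ sym)) ⟩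
    1 + δ (walk (suc (suc t))) (walk (suc t)) ∎
    where
    no-stop : walk (suc t) ≢ walk t
    no-stop = noStop t t<k

  ∑-onPath-freeEnds : ∑ (λ w → 𝟙 (onPath w) * freeEnds σ τ w) ≡ 2
  ∑-onPath-freeEnds = trans (∑-visited (freeEnds σ τ) k ≤-refl) (trans (sumUpTo-freeEnds k ≤-refl) (cong suc (δ-≡ stops)))

record PathComponent {n} (σ τ : Fin n → Fin n) (w : Fin n) : Set where
  field
    member          : Fin n → Bool
    sameComp-member : ∀ {v} → T (member v) → ∀ w′ → sameComp σ τ v w′ ≡ member w′
    sameComp-base   : ∀ v → sameComp σ τ v w ≡ member v
    ∑-freeEnds      : ∑ (λ w′ → 𝟙 (member w′) * freeEnds σ τ w′) ≡ 2

pathComponent-τ : ∀ {n} (σ τ : Fin n → Fin n) → IsInvolution σ → IsInvolution τ → ∀ w → τ w ≡ w → PathComponent σ τ w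
pathComponent-τ σ τ σ-inv τ-inv w τw≡w with AlternatingWalk.firstStop σ τ σ-inv τ-inv w τw≡w
... | k , k<n , stops , noStop = record
  { member = onPath ; sameComp-member = sameComp-onPath ; sameComp-base = sameComp-start ; ∑-freeEnds = ∑-onPath-freeEnds }
  where open PathFrom σ τ σ-inv τ-inv w τw≡w k k<n stops noStop

pathComponent : ∀ {n} (σ τ : Fin n → Fin n) → IsInvolution σ → IsInvolution τ →
                ∀ w → σ w ≡ w ⊎ τ w ≡ w → PathComponent σ τ w
pathComponent σ τ σ-inv τ-inv w (inj₂ τw≡w) = pathComponent-τ σ τ σ-inv τ-inv w τw≡w
-- σ ∪ τ and τ ∪ σ are the same graph, in which w is τ-fixed.
pathComponent {n} σ τ σ-inv τ-inv w (inj₁ σw≡w) = record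
  { member          = member
  ; sameComp-member = λ v-in w′ → trans (reach-swap σ τ n _ w′) (sameComp-member v-in w′)
  ; sameComp-base   = λ v → trans (reach-swap σ τ n v w) (sameComp-base v)
  ; ∑-freeEnds      = trans (∑-cong (λ w′ → cong (𝟙 (member w′) *_) (+-comm (δ (σ w′) w′) _))) ∑-freeEnds
  }
  where open PathComponent (pathComponent-τ τ σ τ-inv σ-inv w σw≡w)

isLeast : ∀ {n} → (Fin n → Bool) → Fin n → Bool
isLeast {n} p v = all (λ w → not (p w) ∨ (toℕ v ≤ᵇ toℕ w)) (allFin n)

isLeast-cong : ∀ {n} {p q : Fin n → Bool} → p ≗ q → ∀ v → isLeast p v ≡ isLeast q v
isLeast-cong {n} p≗q v = cong and (map-cong (λ w → cong (λ b → not b ∨ (toℕ v ≤ᵇ toℕ w)) (p≗q w)) (allFin n))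

isLeast-tabulate : ∀ {n} (p : Fin n → Bool) v → isLeast p v ≡ and (tabulate (λ w → not (p w) ∨ (toℕ v ≤ᵇ toℕ w)))
isLeast-tabulate p v = cong and (map-tabulate id (λ w → not (p w) ∨ (toℕ v ≤ᵇ toℕ w)))

and-tabulate-cong : ∀ {n} {f g : Fin n → Bool} → f ≗ g → and (tabulate f) ≡ and (tabulate g)
and-tabulate-cong {zero}  f≗g = refl
and-tabulate-cong {suc n} f≗g = cong₂ _∧_ (f≗g zero) (and-tabulate-cong (f≗g ∘ suc))

and-tabulate-true : ∀ {n} {f : Fin n → Bool} → (∀ w → f w ≡ true) → and (tabulate f) ≡ true
and-tabulate-true {zero}  f≡true = refl
and-tabulate-true {suc n} f≡true = cong₂ _∧_ (f≡true zero) (and-tabulate-true (f≡true ∘ suc))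

suc≤ᵇsuc : ∀ a b → (suc a ≤ᵇ suc b) ≡ (a ≤ᵇ b)
suc≤ᵇsuc zero    b = refl
suc≤ᵇsuc (suc a) b = refl

∑-least : ∀ {n} (p : Fin n → Bool) → Σ (Fin n) (T ∘ p) → ∑ (λ v → 𝟙 (p v ∧ isLeast p v)) ≡ 1
∑-least {suc n} p (a , pa) with bool-cases (p zero)
... | inj₁ p0 = cong₂ _+_ (cong 𝟙 zero-least) (trans (∑-cong suc-not-least) (sum-replicate-zero n))
  where
  zero-least : p zero ∧ isLeast p zero ≡ true
  zero-least = trans (cong (_∧ isLeast p zero) p0)
                     (trans (isLeast-tabulate p zero) (and-tabulate-true (λ w → ∨-zeroʳ (not (p w)))))
  suc-not-least : ∀ v → 𝟙 (p (suc v) ∧ isLeast p (suc v)) ≡ 0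
  suc-not-least v = cong 𝟙 (trans (cong (p (suc v) ∧_) (trans (isLeast-tabulate p (suc v))
                                                               (cong (λ b → (not b ∨ false) ∧ rest) p0)))
                                  (∧-zeroʳ (p (suc v))))
    where
    rest : Bool
    rest = and (tabulate (λ w → not (p (suc w)) ∨ (toℕ (suc v) ≤ᵇ toℕ (suc w))))
... | inj₂ p0 = trans (cong (λ b → 𝟙 (b ∧ isLeast p zero) + ∑ (λ v → 𝟙 (p (suc v) ∧ isLeast p (suc v)))) p0)
                      (trans (∑-cong suc-least) (∑-least (p ∘ suc) (witness a pa)))
  where
  open ≡-Reasoning
  suc-least : ∀ v → 𝟙 (p (suc v) ∧ isLeast p (suc v)) ≡ 𝟙 (p (suc v) ∧ isLeast (p ∘ suc) v)
  suc-least v = cong (λ b → 𝟙 (p (suc v) ∧ b)) (begin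
    isLeast p (suc v)
      ≡⟨ isLeast-tabulate p (suc v) ⟩
    (not (p zero) ∨ false) ∧ and (tabulate (λ w → not (p (suc w)) ∨ (suc (toℕ v) ≤ᵇ suc (toℕ w))))
      ≡⟨ cong₂ (λ b c → (not b ∨ false) ∧ c) p0
               (and-tabulate-cong (λ w → cong (not (p (suc w)) ∨_) (suc≤ᵇsuc (toℕ v) (toℕ w)))) ⟩
    and (tabulate (λ w → not (p (suc w)) ∨ (toℕ v ≤ᵇ toℕ w)))
      ≡⟨ sym (isLeast-tabulate (p ∘ suc) v) ⟩
    isLeast (p ∘ suc) v ∎)
  witness : ∀ a → T (p a) → Σ (Fin n) (T ∘ p ∘ suc)
  witness zero    pa = ⊥-elim (subst T p0 pa)
  witness (suc b) pb = b , pb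

module FreeEndCount {n} (σ τ : Fin n → Fin n) (σ-inv : IsInvolution σ) (τ-inv : IsInvolution τ) where

  open ≡-Reasoning

  hasFreeEnd : Fin n → Bool
  hasFreeEnd w = does (σ w ≟ w) ∨ does (τ w ≟ w)

  freeEnds-none : ∀ {w} → ¬ T (hasFreeEnd w) → freeEnds σ τ w ≡ 0
  freeEnds-none {w} none = cong₂ _+_ (δ-≢ (none ∘ from T-∨ ∘ inj₁ ∘ does-complete (σ w ≟ w)))
                                    (δ-≢ (none ∘ from (T-∨ {does (σ w ≟ w)}) ∘ inj₂ ∘ does-complete (τ w ≟ w)))

  freeEnd-fixed : ∀ {w} → T (hasFreeEnd w) → σ w ≡ w ⊎ τ w ≡ w
  freeEnd-fixed {w} free with to (T-∨ {does (σ w ≟ w)}) free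
  ... | inj₁ σ-fixed = inj₁ (does-sound (σ w ≟ w) σ-fixed)
  ... | inj₂ τ-fixed = inj₂ (does-sound (τ w ≟ w) τ-fixed)

  ∑-sameComp-freeEnds : ∀ v → ∑ (λ w → 𝟙 (sameComp σ τ v w) * freeEnds σ τ w) ≡ 2 * 𝟙 (isPathComp σ τ v)
  ∑-sameComp-freeEnds v with bool-cases (isPathComp σ τ v)
  ... | inj₁ path = trans component-sum (cong (λ b → 2 * 𝟙 b) (sym path))
    where
    witness : Σ (Fin n) (λ w → T (sameComp σ τ v w ∧ hasFreeEnd w))
    witness = satisfied (any⁻ (λ w → sameComp σ τ v w ∧ hasFreeEnd w) (allFin n) (subst T (sym path) _))
    w₀ : Fin n
    w₀ = proj₁ witness
    v~w₀ : T (sameComp σ τ v w₀)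
    v~w₀ = proj₁ (to T-∧ (proj₂ witness))
    open PathComponent (pathComponent σ τ σ-inv τ-inv w₀ (freeEnd-fixed (proj₂ (to (T-∧ {sameComp σ τ v w₀}) (proj₂ witness)))))
    component-sum : ∑ (λ w → 𝟙 (sameComp σ τ v w) * freeEnds σ τ w) ≡ 2
    component-sum = trans (∑-cong (λ w → cong (λ b → 𝟙 b * freeEnds σ τ w)
                                              (sameComp-member (subst T (sameComp-base v) v~w₀) w)))
                          ∑-freeEnds
  ... | inj₂ cycle = trans (∑-cong noFreeEnd) (trans (sum-replicate-zero n) (cong (λ b → 2 * 𝟙 b) (sym cycle)))
    where
    noFreeEnd : ∀ w → 𝟙 (sameComp σ τ v w) * freeEnds σ τ w ≡ 0
    noFreeEnd w with bool-cases (sameComp σ τ v w)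
    ... | inj₂ apart = cong (λ b → 𝟙 b * freeEnds σ τ w) apart
    ... | inj₁ joined = trans (cong (λ b → 𝟙 b * freeEnds σ τ w) joined) (trans (+-identityʳ _) (freeEnds-none none))
      where
      none : ¬ T (hasFreeEnd w)
      none free = subst T cycle (any⁺ (λ w → sameComp σ τ v w ∧ hasFreeEnd w)
                                       (lose (∈-allFin w) (from T-∧ (subst T (sym joined) _ , free))))

  ∑-representative : ∀ {w} → PathComponent σ τ w → ∑ (λ v → 𝟙 (isRep σ τ v) * 𝟙 (sameComp σ τ v w)) ≡ 1
  ∑-representative {w} comp = trans (∑-cong pointwise) (∑-least member (w , subst T (sameComp-base w) (Reach.reach-refl σ τ n w)))
    where
    open PathComponent comp
    pointwise : ∀ v → 𝟙 (isRep σ τ v) * 𝟙 (sameComp σ τ v w) ≡ 𝟙 (member v ∧ isLeast member v)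
    pointwise v with bool-cases (member v)
    ... | inj₂ out = begin
      𝟙 (isRep σ τ v) * 𝟙 (sameComp σ τ v w) ≡⟨ cong (λ b → 𝟙 (isRep σ τ v) * 𝟙 b) (trans (sameComp-base v) out) ⟩
      𝟙 (isRep σ τ v) * 0                     ≡⟨ *-zeroʳ (𝟙 (isRep σ τ v)) ⟩
      0                                       ≡⟨ cong (λ b → 𝟙 (b ∧ isLeast member v)) (sym out) ⟩
      𝟙 (member v ∧ isLeast member v)         ∎
    ... | inj₁ in′ = begin
      𝟙 (isRep σ τ v) * 𝟙 (sameComp σ τ v w) ≡⟨ cong (λ b → 𝟙 (isRep σ τ v) * 𝟙 b) (trans (sameComp-base v) in′) ⟩
      𝟙 (isRep σ τ v) * 1                     ≡⟨ *-identityʳ _ ⟩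
      𝟙 (isLeast (sameComp σ τ v) v)          ≡⟨ cong 𝟙 (isLeast-cong (sameComp-member (subst T (sym in′) _)) v) ⟩
      𝟙 (isLeast member v)                    ≡⟨ cong (λ b → 𝟙 (b ∧ isLeast member v)) (sym in′) ⟩
      𝟙 (member v ∧ isLeast member v)         ∎

  freeEnds-representative : ∀ w → freeEnds σ τ w * ∑ (λ v → 𝟙 (isRep σ τ v) * 𝟙 (sameComp σ τ v w)) ≡ freeEnds σ τ w
  freeEnds-representative w with T? (hasFreeEnd w)
  ... | yes free = trans (cong (freeEnds σ τ w *_) (∑-representative (pathComponent σ τ σ-inv τ-inv w (freeEnd-fixed free))))
                         (*-identityʳ _)
  ... | no none  = trans (cong (_* ∑ (λ v → 𝟙 (isRep σ τ v) * 𝟙 (sameComp σ τ v w))) (freeEnds-none none))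
                         (sym (freeEnds-none none))

  -- Double counting of the pairs (v, w) with v the representative of a path and w one of its free ends.
  twice-pathComponents : 2 * pathComponents σ τ ≡ fixedPoints σ + fixedPoints τ
  twice-pathComponents = begin
    2 * pathComponents σ τ
      ≡⟨ cong (2 *_) (trans (length-filter (λ v → T? (R v ∧ Q v)) (allFin n)) (sum-map-allFin (λ v → 𝟙 (R v ∧ Q v)))) ⟩
    2 * ∑ (λ v → 𝟙 (R v ∧ Q v))
      ≡⟨ *-distribˡ-sum 2 (λ v → 𝟙 (R v ∧ Q v)) ⟩
    ∑ (λ v → 2 * 𝟙 (R v ∧ Q v))
      ≡⟨ ∑-cong (λ v → 𝟙-∧-* (R v) (Q v)) ⟩
    ∑ (λ v → 𝟙 (R v) * (2 * 𝟙 (Q v)))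
      ≡⟨ ∑-cong (λ v → cong (𝟙 (R v) *_) (sym (∑-sameComp-freeEnds v))) ⟩
    ∑ (λ v → 𝟙 (R v) * ∑ (λ w → 𝟙 (sameComp σ τ v w) * freeEnds σ τ w))
      ≡⟨ ∑-cong (λ v → *-distribˡ-sum (𝟙 (R v)) (λ w → 𝟙 (sameComp σ τ v w) * freeEnds σ τ w)) ⟩
    ∑ (λ v → ∑ (λ w → 𝟙 (R v) * (𝟙 (sameComp σ τ v w) * freeEnds σ τ w)))
      ≡⟨ ∑-comm (λ v w → 𝟙 (R v) * (𝟙 (sameComp σ τ v w) * freeEnds σ τ w)) ⟩
    ∑ (λ w → ∑ (λ v → 𝟙 (R v) * (𝟙 (sameComp σ τ v w) * freeEnds σ τ w)))
      ≡⟨ ∑-cong (λ w → trans (∑-cong (λ v → rearrange (𝟙 (R v)) (𝟙 (sameComp σ τ v w)) (freeEnds σ τ w)))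
                             (sym (*-distribˡ-sum (freeEnds σ τ w) (λ v → 𝟙 (R v) * 𝟙 (sameComp σ τ v w))))) ⟩
    ∑ (λ w → freeEnds σ τ w * ∑ (λ v → 𝟙 (R v) * 𝟙 (sameComp σ τ v w)))
      ≡⟨ ∑-cong freeEnds-representative ⟩
    ∑ (λ w → δ (σ w) w + δ (τ w) w)
      ≡⟨ ∑-distrib-+ (λ w → δ (σ w) w) (λ w → δ (τ w) w) ⟩
    fixedPoints σ + fixedPoints τ ∎
    where
    R Q : Fin n → Bool
    R = isRep σ τ
    Q = isPathComp σ τ
    𝟙-∧-* : ∀ a b → 2 * 𝟙 (a ∧ b) ≡ 𝟙 a * (2 * 𝟙 b)
    𝟙-∧-* true  b = sym (+-identityʳ _)
    𝟙-∧-* false b = refl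
    rearrange : ∀ a b c → a * (b * c) ≡ c * (a * b)
    rearrange = solve-∀

sum-involutionPairs : ∀ n (h : (Fin n → Fin n) → (Fin n → Fin n) → ℕ) →
  sum (concatMap (λ σ → map (h σ) (involutions n)) (involutions n)) ≡ ∑inv n (λ σ → ∑inv n (h σ))
sum-involutionPairs n h =
  trans (sum-concatMap (λ σ → map (h σ) (involutions n)) (involutions n))
    (trans (sum-map-filter isInvolution? (λ σ → sum (map (h σ) (involutions n))) (allFuns n n))
      (∑funs-cong {n} {n} (λ σ → cong (𝟙-inv σ *_) (sum-map-filter isInvolution? (h σ) (allFuns n n)))))

totalPaths-≡ : ∀ n → totalPaths n ≡ ∑inv n fixedPoints * involutionCount n
totalPaths-≡ n = *-cancelˡ-≡ (totalPaths n) _ 2 (begin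
  2 * totalPaths n
    ≡⟨ cong (2 *_) (sum-involutionPairs n pathComponents) ⟩
  2 * ∑inv n (λ σ → ∑inv n (pathComponents σ))
    ≡⟨ sym (∑inv-*ˡ {n} 2 _) ⟩
  ∑inv n (λ σ → 2 * ∑inv n (pathComponents σ))
    ≡⟨ ∑inv-cong {n} (λ σ _ → sym (∑inv-*ˡ {n} 2 (pathComponents σ))) ⟩
  ∑inv n (λ σ → ∑inv n (λ τ → 2 * pathComponents σ τ))
    ≡⟨ ∑inv-cong {n} (λ σ σ-inv → ∑inv-cong {n} (λ τ τ-inv → FreeEndCount.twice-pathComponents σ τ σ-inv τ-inv)) ⟩
  ∑inv n (λ σ → ∑inv n (λ τ → fixedPoints σ + fixedPoints τ))
    ≡⟨ ∑inv-cong {n} (λ σ _ → trans (∑inv-+ {n} (λ _ → fixedPoints σ) fixedPoints)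
                                    (cong (_+ F) (∑inv-const {n} (fixedPoints σ)))) ⟩
  ∑inv n (λ σ → I * fixedPoints σ + F)
    ≡⟨ ∑inv-+ {n} (λ σ → I * fixedPoints σ) (λ _ → F) ⟩
  ∑inv n (λ σ → I * fixedPoints σ) + ∑inv n (λ _ → F)
    ≡⟨ cong₂ _+_ (∑inv-*ˡ {n} I fixedPoints) (∑inv-const {n} F) ⟩
  I * F + I * F
    ≡⟨ x+x≡2[y*x] I F ⟩
  2 * (F * I) ∎)
  where
  open ≡-Reasoning
  F I : ℕ
  F = ∑inv n fixedPoints
  I = involutionCount n
  x+x≡2[y*x] : ∀ i f → i * f + i * f ≡ 2 * (f * i)
  x+x≡2[y*x] = solve-∀


-- The involution recurrence and the mean

module RecurrenceBounds (x : ℕ → ℕ) (x₁≡x₀ : x 1 ≡ x 0)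
                        (recurrence : ∀ n → x (suc (suc n)) ≡ x (suc n) + suc n * x n) where

  open ≤-Reasoning

  Bounds : ℕ → Set
  Bounds m = Σ ℕ λ d → x (suc m) ≡ x m + d × suc m * (x m * x m) ≤ x (suc m) * x (suc m) × d * d ≤ suc m * (x m * x m)

  private
    lower-step : ∀ c z d → c * (z * z) ≤ (z + d) * (z + d) → c * z * (c * z) ≤ suc c * ((z + d) * (z + d))
    lower-step c z d h = begin
      c * z * (c * z)             ≡⟨ reassoc c z ⟩
      c * (c * (z * z))           ≤⟨ *-monoʳ-≤ c h ⟩
      c * ((z + d) * (z + d))     ≤⟨ m≤n+m _ ((z + d) * (z + d)) ⟩
      suc c * ((z + d) * (z + d)) ∎
      where
      reassoc : ∀ c z → c * z * (c * z) ≡ c * (c * (z * z))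
      reassoc = solve-∀

    upper-step : ∀ c z d → d * d ≤ c * (z * z) → suc c * ((z + d) * (z + d)) ≤ (z + d + c * z) * (z + d + c * z)
    upper-step c z d h = begin
      suc c * ((z + d) * (z + d))                             ≡⟨ expand₁ c z d ⟩
      (z + d) * (z + d) + c * (z * z + 2 * z * d + d * d)     ≤⟨ +-monoʳ-≤ ((z + d) * (z + d)) (*-monoʳ-≤ c (+-monoʳ-≤ (z * z + 2 * z * d) d²≤)) ⟩
      (z + d) * (z + d) + c * (z * z + 2 * z * d + (z * z + c * (z * z))) ≡⟨ expand₂ c z d ⟩
      (z + d + c * z) * (z + d + c * z)                       ∎
      where
      d²≤ : d * d ≤ z * z + c * (z * z)
      d²≤ = ≤-trans h (m≤n+m _ (z * z))
      expand₁ : ∀ c z d → suc c * ((z + d) * (z + d)) ≡ (z + d) * (z + d) + c * (z * z + 2 * z * d + d * d)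
      expand₁ = solve-∀
      expand₂ : ∀ c z d → (z + d) * (z + d) + c * (z * z + 2 * z * d + (z * z + c * (z * z))) ≡ (z + d + c * z) * (z + d + c * z)
      expand₂ = solve-∀

  bounds : ∀ m → Bounds m
  bounds zero = 0 , trans x₁≡x₀ (sym (+-identityʳ (x 0)))
                , ≤-reflexive (trans (+-identityʳ _) (cong (λ y → y * y) (sym x₁≡x₀))) , z≤n
  bounds (suc m) with bounds m
  ... | d , x′≡x+d , lower , upper = suc m * x m , x″≡ , lower′ , upper′
    where
    x″≡ : x (suc (suc m)) ≡ x (suc m) + suc m * x m
    x″≡ = recurrence m
    lower′ : suc (suc m) * (x (suc m) * x (suc m)) ≤ x (suc (suc m)) * x (suc (suc m))
    lower′ = subst₂ (λ a b → suc (suc m) * (a * a) ≤ b * b) (sym x′≡x+d) (sym (trans x″≡ (cong (_+ suc m * x m) x′≡x+d)))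
                    (upper-step (suc m) (x m) d upper)
    upper′ : suc m * x m * (suc m * x m) ≤ suc (suc m) * (x (suc m) * x (suc m))
    upper′ = subst (λ a → suc m * x m * (suc m * x m) ≤ suc (suc m) * (a * a)) (sym x′≡x+d)
                   (lower-step (suc m) (x m) d (subst (λ a → suc m * (x m * x m) ≤ a * a) x′≡x+d lower))

-- The mean is T / M with T = n · b · a and M = a · a; the two conclusions say √n - 1 ≤ T / M ≤ √n + 1.
mean-within-one-of-√ : ∀ n b d → n * (b * b) ≤ (b + d) * (b + d) → d * d ≤ n * (b * b) →
  let a = b + d in
  (n * (a * a) ^ 2 ≤ (n * b * a + 1 * (a * a)) ^ 2) × ((n * b * a ∸ 1 * (a * a)) ^ 2 ≤ n * (a * a) ^ 2)
mean-within-one-of-√ n b d lower upper = above , below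
  where
  open ≤-Reasoning
  a : ℕ
  a = b + d
  square-bound : n * (a * a) ≤ (n * b + a) * (n * b + a)
  square-bound = begin
    n * (a * a)                                          ≡⟨ expand n b d ⟩
    n * (b * b) + 2 * n * b * d + n * (d * d)            ≤⟨ +-monoʳ-≤ (n * (b * b) + 2 * n * b * d) (*-monoʳ-≤ n upper) ⟩
    n * (b * b) + 2 * n * b * d + n * (n * (b * b))      ≤⟨ m≤m+n _ (n * (b * b) + a * a) ⟩
    n * (b * b) + 2 * n * b * d + n * (n * (b * b)) + (n * (b * b) + a * a) ≡⟨ collect n b d ⟩
    (n * b + a) * (n * b + a)                            ∎
    where
    expand : ∀ n b d → n * ((b + d) * (b + d)) ≡ n * (b * b) + 2 * n * b * d + n * (d * d)
    expand = solve-∀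
    collect : ∀ n b d → n * (b * b) + 2 * n * b * d + n * (n * (b * b)) + (n * (b * b) + (b + d) * (b + d))
                        ≡ (n * b + (b + d)) * (n * b + (b + d))
    collect = solve-∀
  above : n * (a * a) ^ 2 ≤ (n * b * a + 1 * (a * a)) ^ 2
  above = begin
    n * (a * a) ^ 2                        ≡⟨ factor n a ⟩
    (a * a) * (n * (a * a))                ≤⟨ *-monoʳ-≤ (a * a) square-bound ⟩
    (a * a) * ((n * b + a) * (n * b + a))  ≡⟨ unfactor n b a ⟩
    (n * b * a + 1 * (a * a)) ^ 2          ∎
    where
    factor : ∀ n a → n * ((a * a) * ((a * a) * 1)) ≡ (a * a) * (n * (a * a))
    factor = solve-∀
    unfactor : ∀ n b a → (a * a) * ((n * b + a) * (n * b + a)) ≡ (n * b * a + 1 * (a * a)) * ((n * b * a + 1 * (a * a)) * 1)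
    unfactor = solve-∀
  below : (n * b * a ∸ 1 * (a * a)) ^ 2 ≤ n * (a * a) ^ 2
  below = begin
    (n * b * a ∸ 1 * (a * a)) ^ 2   ≤⟨ *-mono-≤ t∸≤t (*-mono-≤ t∸≤t ≤-refl) ⟩
    (n * b * a) ^ 2                 ≡⟨ factor n b a ⟩
    (a * a) * (n * (n * (b * b)))   ≤⟨ *-monoʳ-≤ (a * a) (*-monoʳ-≤ n lower) ⟩
    (a * a) * (n * (a * a))         ≡⟨ refactor n a ⟩
    n * (a * a) ^ 2                 ∎
    where
    t∸≤t : n * b * a ∸ 1 * (a * a) ≤ n * b * a
    t∸≤t = m∸n≤m (n * b * a) (1 * (a * a))
    factor : ∀ n b a → (n * b * a) * ((n * b * a) * 1) ≡ (a * a) * (n * (n * (b * b)))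
    factor = solve-∀
    refactor : ∀ n a → (a * a) * (n * (a * a)) ≡ n * ((a * a) * ((a * a) * 1))
    refactor = solve-∀

open RecurrenceBounds involutionCount refl involutionCount-suc-suc

numPairs-≡ : ∀ n → numPairs n ≡ involutionCount n * involutionCount n
numPairs-≡ n = cong₂ _*_ (length-involutions n) (length-involutions n)

totalPaths-suc : ∀ m → totalPaths (suc m) ≡ suc m * involutionCount m * involutionCount (suc m)
totalPaths-suc m = trans (totalPaths-≡ (suc m)) (cong (_* involutionCount (suc m)) (∑inv-fixedPoints m))

pathCount-bounds : ∀ m → let n = suc m in
  (n * numPairs n ^ 2 ≤ (totalPaths n + 1 * numPairs n) ^ 2) × ((totalPaths n ∸ 1 * numPairs n) ^ 2 ≤ n * numPairs n ^ 2)
pathCount-bounds m with bounds m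
... | d , I′≡I+d , lower , upper rewrite numPairs-≡ (suc m) | totalPaths-suc m | I′≡I+d =
  mean-within-one-of-√ (suc m) (involutionCount m) d lower upper

mainTheorem8 : Σ ℕ (λ C → Σ ℕ (λ N → (n : ℕ) → N ≤ n →
                 (n * numPairs n ^ 2 ≤ (totalPaths n + C * numPairs n) ^ 2)
                 × ((totalPaths n ∸ C * numPairs n) ^ 2 ≤ n * numPairs n ^ 2)))
mainTheorem8 = 1 , 1 , λ { (suc m) _ → pathCount-bounds m }
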